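{- Let $Trans_1, Trans_2, \ldots, Trans_{r_R}$ be the $r_R$ postfixes, in a given node of the DFA, of the tuples obtained (by following the chain of 0-labelled edges from the initial node to that node) from the $r_R$ tuples of the initial node whose postfixes are the standard basis postfixes $SBP_0=(1,0,\ldots,0), SBP_1=(0,1,0,\ldots,0), \ldots, SBP_{r_R-1}=(0,\ldots,0,1)$. If $Trans_1, \ldots, Trans_{r_R}$ are linearly independent over $\mathbb{Z}_2$, then the node is reversible; otherwise the node is irreversible.
   Context: Consider a one-dimensional linear cellular automaton over $\mathbb{Z}_2$ with $n$ cells under null boundary condition ($s_i^t=0$ for $i\notin\{1,\ldots,n\}$), with neighbor vector $(-r_L,\ldots,0,\ldots,r_R)$, $r_L>0$, $r_R>0$, and linear rule $s_i^{t+1}=(\lambda_{ -r_L}s^t_{i-r_L}+\cdots+\lambda_0 s^t_i+\cdots+\lambda_{r_R}s^t_{i+r_R}) \bmod 2$ with $\lambda_j\in\{0,1\}$ and $\lambda_{ -r_L}=\lambda_{r_R}=1$. The associated DFA is built as follows. A tuple is a binary vector of length $r_L+r_R$; its prefix is its first $r_L$ entries and its postfix its last $r_R$ entries. A node is a list of $2^{r_R}$ tuples. The initial node consists of the $2^{r_R}$ tuples whose prefix is all zeros and whose postfixes are all $2^{r_R}$ binary vectors of length $r_R$. The next node along a 0-labelled edge is obtained by mapping each tuple $(s_{i-r_L},\ldots,s_{i+r_R-1})$ to $(s_{i-r_L+1},\ldots,s_{i+r_R})$, where $s_{i+r_R}$ is the unique value with $\lambda_{ -r_L}s_{i-r_L}+\cdots+\lambda_{r_R}s_{i+r_R}\equiv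 0 \pmod 2$; repeating this returns to the initial node after a number of steps called the period. The $k$-th node is called reversible if the LCA with $n=k+m\cdot\text{period}$ cells ($m\ge 0$) is reversible; it is known that a node is reversible if and only if the postfixes of its $2^{r_R}$ tuples are pairwise distinct. -}

module Defs where

open import Data.Nat using (ℕ; zero; suc; _+_; _<_)
open import Data.Bool using (Bool; true; false; _∧_; _xor_)
open import Data.Fin using (Fin)
open import Data.Vec using (Vec; []; _∷_; replicate; take; drop; zipWith; foldr; lookup; tail; _∷ʳ_; _++_; last; tabulate)
open import Relation.Binary.PropositionalEquality using (_≡_)
open import Relation.Nullary using (¬_)
open import Data.Fin using (_≟_)
open import Relation.Nullary.Decidable using (⌊_⌋)

-- Z_2 is modelled by Bool (false = 0, true = 1, _xor_ = +, _∧_ = *).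

dot : ∀ {n} → Vec Bool n → Vec Bool n → Bool
dot a b = foldr _ _xor_ false (zipWith _∧_ a b)

-- Rule coefficients (λ_{-rL}, …, λ_0, …, λ_{rR}) as a vector of length rL + rR + 1;
-- entry j corresponds to λ_{j - rL}.
Rule : ℕ → ℕ → Set
Rule rL rR = Vec Bool (suc (rL + rR))

Admissible : ∀ rL rR → Rule rL rR → Set
Admissible rL rR lam = (lookup lam Fin.zero ≡ true) × (last lam ≡ true)
  where open import Data.Product using (_×_)
        import Data.Fin as Fin

-- A tuple (s_{i-rL}, …, s_{i+rR-1}).
Tuple : ℕ → ℕ → Set
Tuple rL rR = Vec Bool (rL + rR)

prefix : ∀ {rL rR} → Tuple rL rR → Vec Bool rL
prefix {rL} {rR} t = take rL t

postfix : ∀ {rL rR} → Tuple rL rR → Vec Bool rR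
postfix {rL} {rR} t = drop rL t

lamInit : ∀ {rL rR} → Rule rL rR → Vec Bool (rL + rR)
lamInit {rL} {rR} lam = take (rL + rR) {1} (subst′ lam)
  where
    open import Data.Nat.Properties using (+-comm)
    open import Relation.Binary.PropositionalEquality using (subst)
    subst′ : Vec Bool (suc (rL + rR)) → Vec Bool (rL + rR + 1)
    subst′ v = subst (Vec Bool) (+-comm 1 (rL + rR)) v

-- The unique s_{i+rR} with λ_{-rL}s_{i-rL} + … + λ_{rR}s_{i+rR} ≡ 0 (mod 2),
-- given λ_{rR} = 1: namely s_{i+rR} = λ_{-rL}s_{i-rL} + … + λ_{rR-1}s_{i+rR-1}.
nextBit : ∀ {rL rR} → Rule rL rR → Tuple rL rR → Bool
nextBit {rL} {rR} lam t = dot (lamInit {rL} {rR} lam) t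

-- 0-labelled edge on a single tuple: drop s_{i-rL}, append s_{i+rR}.
step : ∀ {rL rR} → Rule rL rR → Tuple rL rR → Tuple rL rR
step {rL} {rR} lam t = tail (t ∷ʳ nextBit {rL} {rR} lam t)

iter : ∀ {A : Set} → ℕ → (A → A) → A → A
iter zero    f x = x
iter (suc k) f x = f (iter k f x)

initTuple : ∀ {rL rR} → Vec Bool rR → Tuple rL rR
initTuple {rL} p = replicate rL false ++ p

-- The k-th node (k = 0 is the initial node), presented as the list of its 2^rR
-- tuples indexed by the postfix p of the initial-node tuple they come from:
-- nodeTuple lam k p is the image of initTuple p after k 0-labelled edges.
nodeTuple : ∀ {rL rR} → Rule rL rR → ℕ → Vec Bool rR → Tuple rL rR
nodeTuple {rL} {rR} lam k p = iter k (step {rL} {rR} lam) (initTuple {rL} {rR} p)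

-- Reversible node: the postfixes of its 2^rR tuples are pairwise distinct
-- (the known characterization stated in the context).
ReversibleNode : ∀ rL rR → Rule rL rR → ℕ → Set
ReversibleNode rL rR lam k =
  ∀ (p q : Vec Bool rR) → ¬ (p ≡ q) →
    ¬ (postfix {rL} {rR} (nodeTuple {rL} {rR} lam k p) ≡ postfix {rL} {rR} (nodeTuple {rL} {rR} lam k q))

SBP : ∀ {rR} → Fin rR → Vec Bool rR
SBP j = tabulate (λ i → ⌊ i ≟ j ⌋)

Trans : ∀ rL rR → Rule rL rR → ℕ → Fin rR → Vec Bool rR
Trans rL rR lam k j = postfix {rL} {rR} (nodeTuple {rL} {rR} lam k (SBP j))

_⊕_ : ∀ {n} → Vec Bool n → Vec Bool n → Vec Bool n
_⊕_ = zipWith _xor_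

scale : ∀ {n} → Bool → Vec Bool n → Vec Bool n
scale c v = Data.Vec.map (c ∧_) v
  where import Data.Vec

linComb : ∀ {m n} → Vec Bool m → (Fin m → Vec Bool n) → Vec Bool n
linComb {zero}  {n} []       v = replicate n false
linComb {suc m} {n} (c ∷ cs) v = scale c (v Fin.zero) ⊕ linComb cs (λ i → v (Fin.suc i))
  where import Data.Fin as Fin

LinIndep : ∀ {m n} → (Fin m → Vec Bool n) → Set
LinIndep {m} {n} v = ∀ (c : Vec Bool m) → linComb c v ≡ replicate n false → c ≡ replicate m false

{-# OPTIONS --safe #-}
-- Following 0-labelled edges is Z₂-linear: the appended bit s_{i+r_R} is a
-- Z₂-linear form in the tuple, and shifting, padding with zeros and taking
-- postfixes are linear too. Hence the map F sending the postfix p of an initial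
-- tuple to the postfix of its image in the k-th node is linear, Trans_j = F(SBP_j),
-- and Σ c_j Trans_j = F(c). So the Trans_j are independent iff F has trivial
-- kernel, iff F is injective, iff the postfixes in the node are pairwise distinct.
module Submission where

open import Defs
open import Algebra.Bundles using (CommutativeRing)
open import Data.Bool using (Bool; true; false; _xor_; _∧_)
open import Data.Bool.Properties
  using (xor-same; xor-assoc; xor-identityˡ; xor-identityʳ; ∧-distribˡ-xor;
         ∧-identityʳ; ∧-zeroʳ; xor-∧-commutativeRing)
  renaming (_≟_ to _≟ᵇ_)
open import Data.Fin using (Fin; zero; suc)
open import Data.Fin.Properties using (_≟_)
open import Data.Nat using (ℕ; zero; suc; _<_)
open import Data.Product using (_×_; _,_)
open import Data.Vec using (Vec; []; _∷_; replicate; allFin; tail; _∷ʳ_)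
open import Data.Vec.Properties
  using (zipWith-assoc; zipWith-identityˡ; zipWith-identityʳ; map-id; map-const; map-replicate;
         tabulate-cong; tabulate-allFin; drop-zipWith; ≡-dec)
open import Function using (_∘_; _⇔_; mk⇔; Equivalence)
open import Function.Definitions using (Injective)
open import Relation.Binary.Definitions using (DecidableEquality)
open import Relation.Binary.PropositionalEquality
open import Relation.Nullary using (¬_; yes; no; contradiction)
open import Relation.Nullary.Decidable using (⌊⌋-map′)

open import Algebra.Properties.CommutativeSemigroup
  (CommutativeRing.+-commutativeSemigroup xor-∧-commutativeRing)
  using (interchange)

private
  variable
    k m n rL rR : ℕ

0ᵥ : Vec Bool n
0ᵥ = replicate _ false

⊕-assoc : (u v w : Vec Bool n) → (u ⊕ v) ⊕ w ≡ u ⊕ (v ⊕ w)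
⊕-assoc = zipWith-assoc xor-assoc

⊕-identityˡ : (v : Vec Bool n) → 0ᵥ ⊕ v ≡ v
⊕-identityˡ = zipWith-identityˡ xor-identityˡ

⊕-identityʳ : (v : Vec Bool n) → v ⊕ 0ᵥ ≡ v
⊕-identityʳ = zipWith-identityʳ xor-identityʳ

⊕-self : (v : Vec Bool n) → v ⊕ v ≡ 0ᵥ
⊕-self []      = refl
⊕-self (x ∷ v) = cong₂ _∷_ (xor-same x) (⊕-self v)

⊕≡0ᵥ⇒≡ : (u v : Vec Bool n) → u ⊕ v ≡ 0ᵥ → u ≡ v
⊕≡0ᵥ⇒≡ u v u⊕v≡0 = begin
  u              ≡⟨ sym (⊕-identityʳ u) ⟩
  u ⊕ 0ᵥ         ≡⟨ cong (u ⊕_) (sym (⊕-self v)) ⟩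
  u ⊕ (v ⊕ v)    ≡⟨ sym (⊕-assoc u v v) ⟩
  (u ⊕ v) ⊕ v    ≡⟨ cong (_⊕ v) u⊕v≡0 ⟩
  0ᵥ ⊕ v         ≡⟨ ⊕-identityˡ v ⟩
  v              ∎
  where open ≡-Reasoning

linComb-cong : (c : Vec Bool k) {v w : Fin k → Vec Bool n} →
               (∀ i → v i ≡ w i) → linComb c v ≡ linComb c w
linComb-cong []       v≗w = refl
linComb-cong (c ∷ cs) v≗w = cong₂ _⊕_ (cong (scale c) (v≗w zero)) (linComb-cong cs (v≗w ∘ suc))

Additive : (Vec Bool m → Vec Bool n) → Set
Additive f = ∀ u v → f (u ⊕ v) ≡ f u ⊕ f v

false∷-additive : Additive {n} (false ∷_)
false∷-additive _ _ = refl

additive-∘ : {g : Vec Bool n → Vec Bool k} {f : Vec Bool m → Vec Bool n} →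
             Additive g → Additive f → Additive (g ∘ f)
additive-∘ {g = g} g-additive f-additive u v = trans (cong g (f-additive u v)) (g-additive _ _)

additive-iter : {f : Vec Bool n → Vec Bool n} → Additive f → ∀ k → Additive (iter k f)
additive-iter f-additive zero    _ _ = refl
additive-iter f-additive (suc k) = additive-∘ f-additive (additive-iter f-additive k)

tail-additive : Additive {suc n} tail
tail-additive (_ ∷ _) (_ ∷ _) = refl

module _ {f : Vec Bool m → Vec Bool n} (f-additive : Additive f) where

  additive-0ᵥ : f 0ᵥ ≡ 0ᵥ
  additive-0ᵥ = begin
    f 0ᵥ             ≡⟨ cong f (sym (⊕-self 0ᵥ)) ⟩
    f (0ᵥ ⊕ 0ᵥ)      ≡⟨ f-additive 0ᵥ 0ᵥ ⟩
    f 0ᵥ ⊕ f 0ᵥ      ≡⟨ ⊕-self (f 0ᵥ) ⟩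
    0ᵥ               ∎
    where open ≡-Reasoning

  additive-scale : ∀ c v → f (scale c v) ≡ scale c (f v)
  additive-scale true  v = trans (cong f (map-id v)) (sym (map-id (f v)))
  additive-scale false v =
    trans (cong f (map-const v false)) (trans additive-0ᵥ (sym (map-const (f v) false)))

  additive-linComb : (c : Vec Bool k) (v : Fin k → Vec Bool m) →
                     f (linComb c v) ≡ linComb c (f ∘ v)
  additive-linComb []       v = additive-0ᵥ
  additive-linComb (c ∷ cs) v =
    trans (f-additive _ _)
          (cong₂ _⊕_ (additive-scale c (v zero)) (additive-linComb cs (v ∘ suc)))

SBP-zero : SBP zero ≡ true ∷ 0ᵥ {n}
SBP-zero = cong (true ∷_) (trans (tabulate-allFin _) (map-const (allFin _) false))

SBP-suc : (j : Fin n) → SBP (suc j) ≡ false ∷ SBP j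
SBP-suc j = cong (false ∷_) (tabulate-cong (λ i → ⌊⌋-map′ _ _ (i ≟ j)))

scale-0ᵥ : ∀ b → scale b 0ᵥ ≡ 0ᵥ {n}
scale-0ᵥ b = trans (map-replicate (b ∧_) false _) (cong (replicate _) (∧-zeroʳ b))

linComb-SBP : (c : Vec Bool n) → linComb c SBP ≡ c
linComb-SBP []       = refl
linComb-SBP (b ∷ cs) = begin
  scale b (SBP zero) ⊕ linComb cs (SBP ∘ suc)
    ≡⟨ cong₂ _⊕_ (cong (scale b) SBP-zero) (linComb-cong cs SBP-suc) ⟩
  scale b (true ∷ 0ᵥ) ⊕ linComb cs (λ i → false ∷ SBP i)
    ≡⟨ cong (scale b (true ∷ 0ᵥ) ⊕_) (sym (additive-linComb false∷-additive cs SBP)) ⟩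
  ((b ∧ true) xor false) ∷ (scale b 0ᵥ ⊕ linComb cs SBP)
    ≡⟨ cong₂ _∷_ (trans (xor-identityʳ _) (∧-identityʳ b))
                 (trans (cong (_⊕ _) (scale-0ᵥ b)) (⊕-identityˡ _)) ⟩
  b ∷ linComb cs SBP
    ≡⟨ cong (b ∷_) (linComb-SBP cs) ⟩
  b ∷ cs
    ∎
  where open ≡-Reasoning

module _ {f : Vec Bool m → Vec Bool n} (f-additive : Additive f) where

  linComb-basisImage : (c : Vec Bool m) → linComb c (f ∘ SBP) ≡ f c
  linComb-basisImage c = trans (sym (additive-linComb f-additive c SBP)) (cong f (linComb-SBP c))

  LinIndep-basisImage⇔injective : LinIndep (f ∘ SBP) ⇔ Injective _≡_ _≡_ f
  LinIndep-basisImage⇔injective = mk⇔ to from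
    where
    to : LinIndep (f ∘ SBP) → Injective _≡_ _≡_ f
    to indep {p} {q} fp≡fq = ⊕≡0ᵥ⇒≡ p q (indep (p ⊕ q) (begin
      linComb (p ⊕ q) (f ∘ SBP)   ≡⟨ linComb-basisImage (p ⊕ q) ⟩
      f (p ⊕ q)                   ≡⟨ f-additive p q ⟩
      f p ⊕ f q                   ≡⟨ cong (_⊕ f q) fp≡fq ⟩
      f q ⊕ f q                   ≡⟨ ⊕-self (f q) ⟩
      0ᵥ                          ∎))
      where open ≡-Reasoning

    from : Injective _≡_ _≡_ f → LinIndep (f ∘ SBP)
    from inj c Σc≡0 =
      inj (trans (sym (linComb-basisImage c)) (trans Σc≡0 (sym (additive-0ᵥ f-additive))))

separating⇒injective : {A B : Set} {f : A → B} → DecidableEquality A →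
                       (∀ x y → x ≢ y → f x ≢ f y) → Injective _≡_ _≡_ f
separating⇒injective _≟_ separating {x} {y} fx≡fy with x ≟ y
... | yes x≡y = x≡y
... | no  x≢y = contradiction fx≡fy (separating x y x≢y)

∷ʳ-⊕ : (u v : Vec Bool n) (a b : Bool) → (u ∷ʳ a) ⊕ (v ∷ʳ b) ≡ (u ⊕ v) ∷ʳ (a xor b)
∷ʳ-⊕ []      []      a b = refl
∷ʳ-⊕ (x ∷ u) (y ∷ v) a b = cong ((x xor y) ∷_) (∷ʳ-⊕ u v a b)

dot-⊕ʳ : (l u v : Vec Bool n) → dot l (u ⊕ v) ≡ dot l u xor dot l v
dot-⊕ʳ []      []      []      = refl
dot-⊕ʳ (a ∷ l) (x ∷ u) (y ∷ v) =
  trans (cong₂ _xor_ (∧-distribˡ-xor a x y) (dot-⊕ʳ l u v))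
        (interchange (a ∧ x) (a ∧ y) (dot l u) (dot l v))

step-additive : ∀ {rL rR} (lam : Rule rL rR) → Additive (step {rL} {rR} lam)
step-additive {rL} {rR} lam u v = begin
  tail ((u ⊕ v) ∷ʳ next (u ⊕ v))
    ≡⟨ cong (tail ∘ ((u ⊕ v) ∷ʳ_)) (dot-⊕ʳ (lamInit {rL} {rR} lam) u v) ⟩
  tail ((u ⊕ v) ∷ʳ (next u xor next v))
    ≡⟨ cong tail (sym (∷ʳ-⊕ u v (next u) (next v))) ⟩
  tail ((u ∷ʳ next u) ⊕ (v ∷ʳ next v))
    ≡⟨ tail-additive (u ∷ʳ next u) (v ∷ʳ next v) ⟩
  tail (u ∷ʳ next u) ⊕ tail (v ∷ʳ next v)
    ∎
  where
  open ≡-Reasoning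
  next : Tuple rL rR → Bool
  next = nextBit {rL} {rR} lam

initTuple-additive : ∀ rL → Additive (initTuple {rL} {rR})
initTuple-additive zero     _ _ = refl
initTuple-additive (suc rL) = additive-∘ false∷-additive (initTuple-additive rL)

postfix-additive : ∀ rL {rR} → Additive (postfix {rL} {rR})
postfix-additive rL = drop-zipWith {m = rL} _xor_

nodePostfix : ∀ rL rR → Rule rL rR → ℕ → Vec Bool rR → Vec Bool rR
nodePostfix rL rR lam k = postfix {rL} {rR} ∘ nodeTuple {rL} {rR} lam k

nodePostfix-additive : ∀ rL rR (lam : Rule rL rR) k → Additive (nodePostfix rL rR lam k)
nodePostfix-additive rL rR lam k =
  additive-∘ (postfix-additive rL)
    (additive-∘ (additive-iter (step-additive {rL} {rR} lam) k) (initTuple-additive rL))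

theorem7 : (rL rR : ℕ) → 0 < rL → 0 < rR →
    (lam : Rule rL rR) → Admissible rL rR lam → (k : ℕ) →
    (LinIndep (Trans rL rR lam k) → ReversibleNode rL rR lam k) ×
    (¬ LinIndep (Trans rL rR lam k) → ¬ ReversibleNode rL rR lam k)
theorem7 rL rR _ _ lam _ k = reversible , irreversible
  where
  open Equivalence (LinIndep-basisImage⇔injective (nodePostfix-additive rL rR lam k))

  reversible : LinIndep (Trans rL rR lam k) → ReversibleNode rL rR lam k
  reversible independent p q p≢q = p≢q ∘ to independent

  irreversible : ¬ LinIndep (Trans rL rR lam k) → ¬ ReversibleNode rL rR lam k
  irreversible dependent distinct = dependent (from (separating⇒injective (≡-dec _≟ᵇ_) distinct))
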